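{- Let $G$ be a connected bipartite graph that is Schur positive. Then $G$ has a stable bipartition $\{U,V\}$ that is balanced, i.e. $\big||U|-|V|\big|\le 1$.
   Context: The chromatic symmetric function of a graph $G$ is $X_G=\sum_{\kappa}\prod_{v\in V(G)}x_{\kappa(v)}$, summed over all proper colorings $\kappa:V(G)\to\{1,2,\dots\}$. $G$ is Schur positive if all coefficients of $X_G$ in the Schur function basis are nonnegative. A stable bipartition is a partition of $V(G)$ into two stable (independent) sets. -}

module Defs where

open import Data.Bool using (Bool; true; false; _∧_; _∨_; not)
open import Data.Nat using (ℕ; zero; suc; _+_; _*_; _≡ᵇ_; _<ᵇ_; _≤ᵇ_; _≤_; ∣_-_∣)
open import Data.Fin using (Fin; toℕ; zero; suc)
open import Data.List using (List; []; _∷_; [_]; map; concatMap; length; filterᵇ; allFin; foldr)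
open import Data.Product using (Σ; _×_; ∃; _,_)
open import Relation.Binary.PropositionalEquality using (_≡_; _≢_)

record SimpleGraph (n : ℕ) : Set where
  field
    adj    : Fin n → Fin n → Bool
    sym    : ∀ u v → adj u v ≡ adj v u
    irrefl : ∀ v → adj v v ≡ false
open SimpleGraph public

data Reachable {n : ℕ} (G : SimpleGraph n) : Fin n → Fin n → Set where
  here : ∀ {v} → Reachable G v v
  step : ∀ {u w v} → adj G u w ≡ true → Reachable G w v → Reachable G u v

Connected : {n : ℕ} → SimpleGraph n → Set
Connected {n} G = ∀ (u v : Fin n) → Reachable G u v

Proper : {n : ℕ} {C : Set} → SimpleGraph n → (Fin n → C) → Set
Proper {n} G κ = ∀ (u v : Fin n) → adj G u v ≡ true → κ u ≢ κ v

Bipartite : {n : ℕ} → SimpleGraph n → Set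
Bipartite G = ∃ λ (f : Fin _ → Bool) → Proper G f

_==ᶠ_ : {k : ℕ} → Fin k → Fin k → Bool
a ==ᶠ b = toℕ a ≡ᵇ toℕ b

allᶠ : (n : ℕ) → (Fin n → Bool) → Bool
allᶠ n p = foldr (λ i b → p i ∧ b) true (allFin n)

countᶠ : (n : ℕ) → (Fin n → Bool) → ℕ
countᶠ n p = length (filterᵇ p (allFin n))

countL : {A : Set} → List A → (A → Bool) → ℕ
countL xs p = length (filterᵇ p xs)

sumL : {A : Set} → List A → (A → ℕ) → ℕ
sumL xs f = foldr (λ x acc → f x + acc) 0 xs

cons : {m : ℕ} {B : Set} → B → (Fin m → B) → Fin (suc m) → B
cons b f zero    = b
cons b f (suc i) = f i

funsL : {B : Set} → (m : ℕ) → List B → List (Fin m → B)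
funsL zero    bs = [ (λ ()) ]
funsL (suc m) bs = concatMap (λ b → map (cons b) (funsL m bs)) bs

-- Chromatic symmetric function, restricted to n = |V| variables x_0..x_{n-1}
-- (restriction to n variables is injective on homogeneous symmetric
-- functions of degree n).  chromCoeff G α is the coefficient of the
-- monomial x^α in X_G(x_0,…,x_{n-1}).

properᵇ : {n : ℕ} → SimpleGraph n → (Fin n → Fin n) → Bool
properᵇ {n} G κ = allᶠ n λ u → allᶠ n λ v → not (adj G u v) ∨ not (κ u ==ᶠ κ v)

hasContent : {n : ℕ} → (Fin n → Fin n) → (Fin n → ℕ) → Bool
hasContent {n} κ α = allᶠ n λ i → countᶠ n (λ v → κ v ==ᶠ i) ≡ᵇ α i

chromCoeff : {n : ℕ} → SimpleGraph n → (Fin n → ℕ) → ℕ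
chromCoeff {n} G α = countL (funsL n (allFin n)) (λ κ → properᵇ G κ ∧ hasContent κ α)

-- Partitions of n (padded with zeros to length n) and Schur polynomials
-- s_μ(x_0,…,x_{n-1}) via semistandard Young tableaux.

isPartitionᵇ : (n : ℕ) → (Fin n → ℕ) → Bool
isPartitionᵇ n μ =
  (allᶠ n λ i → allᶠ n λ j → not (toℕ i <ᵇ toℕ j) ∨ (μ j ≤ᵇ μ i))
  ∧ (sumL (allFin n) μ ≡ᵇ n)

partitions : (n : ℕ) → List (Fin n → ℕ)
partitions n = filterᵇ (isPartitionᵇ n) (map (λ f i → toℕ (f i)) (funsL n (allFin (suc n))))

-- a filling T (row i, column j) of the n×n box with entries in Fin n;
-- cells outside the shape μ are required to hold 0 (canonical padding),
-- so SSYTs of shape μ correspond bijectively to accepted fillings.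
isSSYTᵇ : {n : ℕ} → (Fin n → ℕ) → (Fin n → Fin n → Fin n) → Bool
isSSYTᵇ {n} μ T =
  (allᶠ n λ i → allᶠ n λ j → not (μ i ≤ᵇ toℕ j) ∨ (toℕ (T i j) ≡ᵇ 0)) ∧
  (allᶠ n λ i → allᶠ n λ j → allᶠ n λ j' →
     not (toℕ j <ᵇ toℕ j') ∨ not (toℕ j' <ᵇ μ i) ∨ (toℕ (T i j) ≤ᵇ toℕ (T i j'))) ∧
  (allᶠ n λ i → allᶠ n λ i' → allᶠ n λ j →
     not (toℕ i <ᵇ toℕ i') ∨ not (toℕ j <ᵇ μ i') ∨ (toℕ (T i j) <ᵇ toℕ (T i' j)))

-- coefficient of x^α in s_μ(x_0,…,x_{n-1}): number of SSYT of shape μ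
-- with entries in {0,…,n-1} and content α
schurCoeff : {n : ℕ} → (Fin n → ℕ) → (Fin n → ℕ) → ℕ
schurCoeff {n} μ α = countL (funsL n (funsL n (allFin n)))
  (λ T → isSSYTᵇ μ T ∧ (allᶠ n λ k →
     sumL (allFin n) (λ i → countᶠ n (λ j → (toℕ j <ᵇ μ i) ∧ (T i j ==ᶠ k))) ≡ᵇ α k))

-- Schur positivity: X_G = Σ_μ c_μ s_μ with all c_μ ∈ ℕ
-- (the Schur expansion is unique, so this says all Schur coefficients are ≥ 0)
SchurPositive : {n : ℕ} → SimpleGraph n → Set
SchurPositive {n} G = Σ ((Fin n → ℕ) → ℕ) λ c →
  ∀ (α : Fin n → ℕ) → chromCoeff G α ≡ sumL (partitions n) (λ μ → c μ * schurCoeff μ α)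

-- stable bipartition {U,V}: U = f⁻¹(true), V = f⁻¹(false), f proper
BalancedStableBipartition : {n : ℕ} → SimpleGraph n → Set
BalancedStableBipartition {n} G = Σ (Fin n → Bool) λ f →
  Proper G f × ∣ countᶠ n (λ v → f v) - countᶠ n (λ v → not (f v)) ∣ ≤ 1

{-# OPTIONS --safe #-}
module Submission where

-- Let h be a proper 2-colouring of G with colour classes of sizes A ≥ B + 2.
-- In the variables x₀, x₁, … the monomial x₀^A x₁^B occurs in X_G (colour by
-- h), but x₀^(A-1) x₁^(B+1) does not: a colouring with that content uses only
-- two colours, and a connected bipartite graph has only the two 2-colourings
-- h and not ∘ h, whose classes have sizes A and B.  On the Schur side, in an
-- SSYT of content (A, B) all zeros lie in the first row and nothing lies below
-- the last of them, so turning that zero into a one gives an SSYT of content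
-- (A-1, B+1).  Hence a Schur expansion with nonnegative coefficients in which
-- x₀^A x₁^B occurs also contains x₀^(A-1) x₁^(B+1).

open import Defs hiding (sym)
open import Data.Bool using (Bool; true; false; T; not; _∧_; _∨_; _xor_)
open import Data.Bool.Properties
  using (T-∧; T-≡; ¬-not; not-involutive; not-injective; not-distribˡ-xor; not-distribʳ-xor)
open import Data.Empty using (⊥; ⊥-elim)
open import Data.Fin using (Fin; zero; suc; toℕ; _≟_)
open import Data.Fin.Properties using (toℕ-injective; suc-injective; any?)
open import Data.List
  using (List; []; _∷_; map; length; filterᵇ; allFin; foldr; tabulate)
open import Data.List.Membership.Propositional using (_∈_)
open import Data.List.Membership.Propositional.Properties using (∈-allFin; ∈-map⁺; ∈-concatMap⁺)
open import Data.List.Properties using (length-filter; filter-none; length-tabulate)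
open import Data.List.Relation.Unary.All using (universal)
open import Data.List.Relation.Unary.Any using (here; there)
import Data.List.Relation.Unary.Any as Any
open import Data.Nat
  using (ℕ; zero; suc; pred; _+_; _*_; _≤_; _<_; z≤n; s≤s; _<ᵇ_; _≤ᵇ_; _≡ᵇ_; ∣_-_∣; _<?_)
open import Data.Nat.Properties
  using ( ≤-trans; ≤-pred; ≤-<-trans; <-trans; <-irrefl; <⇒≱; ≮⇒≥; n≮0; n<1+n; m≤m+n; m≤n+m
        ; +-mono-≤; *-mono-≤; +-assoc; +-identityʳ; *-zeroʳ; +-commutativeSemigroup
        ; ≡ᵇ⇒≡; ≡⇒≡ᵇ; <ᵇ⇒<; <⇒<ᵇ; ≤ᵇ⇒≤; ≤⇒≤ᵇ; module ≤-Reasoning )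
open import Algebra.Properties.CommutativeSemigroup +-commutativeSemigroup using (x∙yz≈y∙xz)
open import Data.Product using (∃; ∃₂; ∃-syntax; _×_; _,_; proj₁; proj₂)
open import Data.Sum using (_⊎_; inj₁; inj₂; [_,_]′) renaming (map to ⊎-map)
open import Function using (_∘_; id)
open import Function.Bundles using (module Equivalence)
open import Relation.Binary.PropositionalEquality
  using (_≡_; _≢_; refl; sym; trans; cong; cong₂; subst; subst₂; _≗_; module ≡-Reasoning)
open import Relation.Nullary using (¬_; yes; no; contradiction)
open import Relation.Nullary.Decidable using (T?; _×-dec_)
open import Relation.Unary using (Decidable)

open Equivalence using (to; from)

private
  variable
    A C : Set
    n : ℕ

indicator : Bool → ℕ
indicator true  = 1
indicator false = 0

indicator-pos : ∀ {b} → T b → 0 < indicator b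
indicator-pos {true} _ = s≤s z≤n

indicator-pos⁻ : ∀ {b} → 0 < indicator b → T b
indicator-pos⁻ {true} _ = _

indicator-mono : ∀ {a b} → (T a → T b) → indicator a ≤ indicator b
indicator-mono {false}        _   = z≤n
indicator-mono {true} {true}  _   = s≤s z≤n
indicator-mono {true} {false} a⇒b = ⊥-elim (a⇒b _)

sumL-cong : (xs : List A) {f g : A → ℕ} → f ≗ g → sumL xs f ≡ sumL xs g
sumL-cong []       f≗g = refl
sumL-cong (x ∷ xs) f≗g = cong₂ _+_ (f≗g x) (sumL-cong xs f≗g)

sumL-zero : (xs : List A) {f : A → ℕ} → (∀ x → f x ≡ 0) → sumL xs f ≡ 0
sumL-zero []       f≡0 = refl
sumL-zero (x ∷ xs) f≡0 = cong₂ _+_ (f≡0 x) (sumL-zero xs f≡0)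

sumL-mono : (xs : List A) {f g : A → ℕ} → (∀ x → f x ≤ g x) → sumL xs f ≤ sumL xs g
sumL-mono []       f≤g = z≤n
sumL-mono (x ∷ xs) f≤g = +-mono-≤ (f≤g x) (sumL-mono xs f≤g)

∈⇒≤sumL : ∀ {xs : List A} {x} (f : A → ℕ) → x ∈ xs → f x ≤ sumL xs f
∈⇒≤sumL              f (here refl)  = m≤m+n _ _
∈⇒≤sumL {xs = y ∷ _} f (there x∈xs) = ≤-trans (∈⇒≤sumL f x∈xs) (m≤n+m _ (f y))

sumL-witness : (xs : List A) (f : A → ℕ) → 0 < sumL xs f → ∃[ x ] x ∈ xs × 0 < f x
sumL-witness (x ∷ xs) f pos with f x in fx≡
... | suc _ = x , here refl , subst (0 <_) (sym fx≡) (s≤s z≤n)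
... | zero with sumL-witness xs f pos
...   | y , y∈xs , fy>0 = y , there y∈xs , fy>0

sumL-tabulate : ∀ n (g : Fin n → A) (f : A → ℕ) → sumL (tabulate g) f ≡ sumL (allFin n) (f ∘ g)
sumL-tabulate zero    g f = refl
sumL-tabulate (suc n) g f =
  cong (f (g zero) +_) (trans (sumL-tabulate n (g ∘ suc) f) (sym (sumL-tabulate n suc (f ∘ g))))

sumL-allFin-suc : (f : Fin (suc n) → ℕ) →
                  sumL (allFin (suc n)) f ≡ f zero + sumL (allFin n) (f ∘ suc)
sumL-allFin-suc {n} f = cong (f zero +_) (sumL-tabulate n suc f)

sumL-allFin-update : (f g : Fin n → ℕ) (k : Fin n) → (∀ j → j ≢ k → f j ≡ g j) →
                     g k + sumL (allFin n) f ≡ f k + sumL (allFin n) g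
sumL-allFin-update {suc n} f g zero f≡g = begin
  g zero + sumL (allFin (suc n)) f              ≡⟨ cong (g zero +_) (sumL-allFin-suc f) ⟩
  g zero + (f zero + sumL (allFin n) (f ∘ suc)) ≡⟨ x∙yz≈y∙xz (g zero) (f zero) _ ⟩
  f zero + (g zero + sumL (allFin n) (f ∘ suc)) ≡⟨ cong (λ s → f zero + (g zero + s)) rest ⟩
  f zero + (g zero + sumL (allFin n) (g ∘ suc)) ≡⟨ cong (f zero +_) (sumL-allFin-suc g) ⟨
  f zero + sumL (allFin (suc n)) g              ∎
  where
  open ≡-Reasoning
  rest : sumL (allFin n) (f ∘ suc) ≡ sumL (allFin n) (g ∘ suc)
  rest = sumL-cong (allFin n) λ j → f≡g (suc j) λ ()
sumL-allFin-update {suc n} f g (suc k) f≡g = begin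
  g (suc k) + sumL (allFin (suc n)) f              ≡⟨ cong (g (suc k) +_) (sumL-allFin-suc f) ⟩
  g (suc k) + (f zero + sumL (allFin n) (f ∘ suc)) ≡⟨ x∙yz≈y∙xz (g (suc k)) (f zero) _ ⟩
  f zero + (g (suc k) + sumL (allFin n) (f ∘ suc)) ≡⟨ cong₂ _+_ (f≡g zero λ ()) rest ⟩
  g zero + (f (suc k) + sumL (allFin n) (g ∘ suc)) ≡⟨ x∙yz≈y∙xz (g zero) (f (suc k)) _ ⟩
  f (suc k) + (g zero + sumL (allFin n) (g ∘ suc)) ≡⟨ cong (f (suc k) +_) (sumL-allFin-suc g) ⟨
  f (suc k) + sumL (allFin (suc n)) g              ∎
  where
  open ≡-Reasoning
  rest : g (suc k) + sumL (allFin n) (f ∘ suc) ≡ f (suc k) + sumL (allFin n) (g ∘ suc)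
  rest = sumL-allFin-update (f ∘ suc) (g ∘ suc) k λ j j≢k → f≡g (suc j) (j≢k ∘ suc-injective)

length-filterᵇ : (p : A → Bool) (xs : List A) → length (filterᵇ p xs) ≡ sumL xs (indicator ∘ p)
length-filterᵇ p []       = refl
length-filterᵇ p (x ∷ xs) with p x
... | true  = cong suc (length-filterᵇ p xs)
... | false = length-filterᵇ p xs

countL-pos : ∀ {xs : List A} {x} (p : A → Bool) → x ∈ xs → T (p x) → 0 < countL xs p
countL-pos {xs = xs} p x∈xs px = subst (0 <_) (sym (length-filterᵇ p xs))
  (≤-trans (indicator-pos px) (∈⇒≤sumL (indicator ∘ p) x∈xs))

countL-witness : (xs : List A) (p : A → Bool) → 0 < countL xs p → ∃[ x ] T (p x)
countL-witness xs p pos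
  with x , _ , px>0 ← sumL-witness xs (indicator ∘ p) (subst (0 <_) (length-filterᵇ p xs) pos) =
  x , indicator-pos⁻ px>0

countL-none : (xs : List A) (p : A → Bool) → (∀ x → ¬ T (p x)) → countL xs p ≡ 0
countL-none xs p ¬p = cong length (filter-none (T? ∘ p) (universal ¬p xs))

countᶠ-cong : {p q : Fin n → Bool} → p ≗ q → countᶠ n p ≡ countᶠ n q
countᶠ-cong {n} {p} {q} p≗q = begin
  countᶠ n p                      ≡⟨ length-filterᵇ p (allFin n) ⟩
  sumL (allFin n) (indicator ∘ p) ≡⟨ sumL-cong (allFin n) (cong indicator ∘ p≗q) ⟩
  sumL (allFin n) (indicator ∘ q) ≡⟨ length-filterᵇ q (allFin n) ⟨
  countᶠ n q                      ∎
  where open ≡-Reasoning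

countᶠ-mono : {p q : Fin n → Bool} → (∀ i → T (p i) → T (q i)) → countᶠ n p ≤ countᶠ n q
countᶠ-mono {n} {p} {q} p⇒q = begin
  countᶠ n p                      ≡⟨ length-filterᵇ p (allFin n) ⟩
  sumL (allFin n) (indicator ∘ p) ≤⟨ sumL-mono (allFin n) (λ i → indicator-mono (p⇒q i)) ⟩
  sumL (allFin n) (indicator ∘ q) ≡⟨ length-filterᵇ q (allFin n) ⟨
  countᶠ n q                      ∎
  where open ≤-Reasoning

countᶠ-≤ : (p : Fin n → Bool) → countᶠ n p ≤ n
countᶠ-≤ {n} p = subst (countᶠ n p ≤_) (length-tabulate id) (length-filter (T? ∘ p) (allFin n))

countᶠ-update : (p q : Fin n → Bool) (k : Fin n) → (∀ j → j ≢ k → p j ≡ q j) →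
                indicator (q k) + countᶠ n p ≡ indicator (p k) + countᶠ n q
countᶠ-update {n} p q k p≡q = begin
  indicator (q k) + countᶠ n p                      ≡⟨ cong (indicator (q k) +_) (length-filterᵇ p (allFin n)) ⟩
  indicator (q k) + sumL (allFin n) (indicator ∘ p) ≡⟨ sumL-allFin-update (indicator ∘ p) (indicator ∘ q) k
                                                         (λ j j≢k → cong indicator (p≡q j j≢k)) ⟩
  indicator (p k) + sumL (allFin n) (indicator ∘ q) ≡⟨ cong (indicator (p k) +_) (length-filterᵇ q (allFin n)) ⟨
  indicator (p k) + countᶠ n q                      ∎
  where open ≡-Reasoning

foldr-∧⁺ : {p : A → Bool} (xs : List A) → (∀ {x} → x ∈ xs → T (p x)) →
           T (foldr (λ x b → p x ∧ b) true xs)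
foldr-∧⁺ []       _  = _
foldr-∧⁺ (x ∷ xs) px = from T-∧ (px (here refl) , foldr-∧⁺ xs (px ∘ there))

foldr-∧⁻ : {p : A → Bool} (xs : List A) → T (foldr (λ x b → p x ∧ b) true xs) →
           ∀ {x} → x ∈ xs → T (p x)
foldr-∧⁻ (x ∷ xs) t (here refl)  = proj₁ (to T-∧ t)
foldr-∧⁻ (x ∷ xs) t (there x∈xs) = foldr-∧⁻ xs (proj₂ (to T-∧ t)) x∈xs

allᶠ⁺ : {p : Fin n → Bool} → (∀ i → T (p i)) → T (allᶠ n p)
allᶠ⁺ {n} p = foldr-∧⁺ (allFin n) (λ {i} _ → p i)

allᶠ⁻ : {p : Fin n → Bool} → T (allᶠ n p) → ∀ i → T (p i)
allᶠ⁻ {n} t i = foldr-∧⁻ (allFin n) t (∈-allFin i)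

T-∧⁻ : ∀ a {b} → T (a ∧ b) → T a × T b
T-∧⁻ _ = to T-∧

impᵇ⁺ : ∀ a {b} → (T a → T b) → T (not a ∨ b)
impᵇ⁺ true  a⇒b = a⇒b _
impᵇ⁺ false _   = _

impᵇ⁻ : ∀ a {b} → T (not a ∨ b) → T a → T b
impᵇ⁻ true t _ = t

notᵇ⁺ : ∀ {a} → ¬ T a → T (not a)
notᵇ⁺ {true}  ¬a = ¬a _
notᵇ⁺ {false} _  = _

notᵇ⁻ : ∀ {a} → T (not a) → ¬ T a
notᵇ⁻ {false} _ ()

not-xor-not : ∀ x y → not x xor not y ≡ x xor y
not-xor-not x y = begin
  not x xor not y     ≡⟨ not-distribˡ-xor x (not y) ⟨
  not (x xor not y)   ≡⟨ cong not (not-distribʳ-xor x y) ⟨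
  not (not (x xor y)) ≡⟨ not-involutive (x xor y) ⟩
  x xor y             ∎
  where open ≡-Reasoning

xor-cancelʳ : ∀ x y → x ≡ (x xor y) xor y
xor-cancelʳ true  true  = refl
xor-cancelʳ true  false = refl
xor-cancelʳ false true  = refl
xor-cancelʳ false false = refl

==ᶠ⇒≡ : {i j : Fin n} → T (i ==ᶠ j) → i ≡ j
==ᶠ⇒≡ t = toℕ-injective (≡ᵇ⇒≡ _ _ t)

≡⇒==ᶠ : {i j : Fin n} → i ≡ j → T (i ==ᶠ j)
≡⇒==ᶠ i≡j = ≡⇒≡ᵇ _ _ (cong toℕ i≡j)

funsL-complete : (_≈_ : C → C → Set) {bs : List C} → (∀ b → ∃[ b' ] b' ∈ bs × b' ≈ b) →
                 ∀ m (f : Fin m → C) → ∃[ g ] g ∈ funsL m bs × (∀ i → g i ≈ f i)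
funsL-complete _≈_ bs-complete zero    f = (λ ()) , here refl , λ ()
funsL-complete _≈_ bs-complete (suc m) f
  with b , b∈bs , b≈f₀ ← bs-complete (f zero)
     | g , g∈ , g≈f    ← funsL-complete _≈_ bs-complete m (f ∘ suc)
  = cons b g
  , ∈-concatMap⁺ (λ b → map (cons b) (funsL m _)) (Any.map (λ { refl → ∈-map⁺ (cons b) g∈ }) b∈bs)
  , λ { zero → b≈f₀ ; (suc i) → g≈f i }

funsL-allFin-complete : ∀ m (f : Fin m → Fin n) → ∃[ g ] g ∈ funsL m (allFin n) × g ≗ f
funsL-allFin-complete = funsL-complete _≡_ (λ b → b , ∈-allFin b , refl)

-- Colourings

colourCount : (Fin n → Fin n) → Fin n → ℕ
colourCount {n} κ c = countᶠ n (λ v → κ v ==ᶠ c)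

module _ {G : SimpleGraph n} where

  Proper-≗ : {κ κ' : Fin n → A} → κ' ≗ κ → Proper G κ → Proper G κ'
  Proper-≗ κ'≗κ proper u v uv κ'u≡κ'v =
    proper u v uv (trans (sym (κ'≗κ u)) (trans κ'u≡κ'v (κ'≗κ v)))

  Proper-∘-injective : {f : Fin n → A} {g : A → C} →
                       (∀ {x y} → g x ≡ g y → x ≡ y) → Proper G f → Proper G (g ∘ f)
  Proper-∘-injective g-injective proper u v uv = proper u v uv ∘ g-injective

  properᵇ⁺ : {κ : Fin n → Fin n} → Proper G κ → T (properᵇ G κ)
  properᵇ⁺ proper = allᶠ⁺ λ u → allᶠ⁺ λ v → impᵇ⁺ (adj G u v) λ uv →
    notᵇ⁺ (proper u v (to T-≡ uv) ∘ ==ᶠ⇒≡)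

  properᵇ⁻ : {κ : Fin n → Fin n} → T (properᵇ G κ) → Proper G κ
  properᵇ⁻ t u v uv κu≡κv =
    notᵇ⁻ (impᵇ⁻ (adj G u v) (allᶠ⁻ (allᶠ⁻ t u) v) (from T-≡ uv)) (≡⇒==ᶠ κu≡κv)

  chromCoeff-pos : {κ : Fin n → Fin n} {α : Fin n → ℕ} →
                   Proper G κ → colourCount κ ≗ α → 0 < chromCoeff G α
  chromCoeff-pos {κ} {α} proper content with κ' , κ'∈ , κ'≗κ ← funsL-allFin-complete n κ =
    countL-pos (λ κ → properᵇ G κ ∧ hasContent κ α) κ'∈
      (from T-∧ (properᵇ⁺ (Proper-≗ κ'≗κ proper) , allᶠ⁺ λ c → ≡⇒≡ᵇ _ _ (trans (count-≗ c) (content c))))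
    where
    count-≗ : colourCount κ' ≗ colourCount κ
    count-≗ c = countᶠ-cong λ v → cong (_==ᶠ c) (κ'≗κ v)

  chromCoeff-witness : {α : Fin n → ℕ} → 0 < chromCoeff G α → ∃[ κ ] Proper G κ × colourCount κ ≗ α
  chromCoeff-witness {α} pos
    with κ , t ← countL-witness (funsL n (allFin n)) (λ κ → properᵇ G κ ∧ hasContent κ α) pos
    with tProper , tContent ← T-∧⁻ (properᵇ G κ) t =
    κ , properᵇ⁻ tProper , λ c → ≡ᵇ⇒≡ _ _ (allᶠ⁻ tContent c)

  reachable-invariant : (f : Fin n → A) → (∀ {u w} → adj G u w ≡ true → f u ≡ f w) →
                        ∀ {u v} → Reachable G u v → f u ≡ f v
  reachable-invariant f edge here          = refl
  reachable-invariant f edge (step uw w⇝v) = trans (edge uw) (reachable-invariant f edge w⇝v)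

  -- Along an edge both colourings flip, so their xor is constant on components.
  twoColouring-unique : Connected G → {h k : Fin n → Bool} → Proper G h → Proper G k →
                        Fin n → k ≗ h ⊎ k ≗ not ∘ h
  twoColouring-unique connected {h} {k} proper-h proper-k v₀ =
    classify (difference v₀) λ v → trans (xor-cancelʳ (k v) (h v)) (cong (_xor h v) (sym (constant v)))
    where
    difference : Fin n → Bool
    difference v = k v xor h v

    difference-edge : ∀ {u w} → adj G u w ≡ true → difference u ≡ difference w
    difference-edge {u} {w} uw
      rewrite ¬-not (proper-k u w uw) | ¬-not (proper-h u w uw) = not-xor-not (k w) (h w)

    constant : ∀ v → difference v₀ ≡ difference v
    constant v = reachable-invariant difference difference-edge (connected v₀ v)

    classify : ∀ c → (∀ v → k v ≡ c xor h v) → k ≗ h ⊎ k ≗ not ∘ h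
    classify false k≡h    = inj₁ k≡h
    classify true  k≡noth = inj₂ k≡noth

twoParts : ∀ {m} → ℕ → ℕ → Fin (suc (suc m)) → ℕ
twoParts a b zero          = a
twoParts a b (suc zero)    = b
twoParts a b (suc (suc _)) = 0

colourBy : ∀ {m} → Bool → Fin (suc (suc m))
colourBy true  = zero
colourBy false = suc zero

colourBy-injective : ∀ {m x y} → colourBy {m} x ≡ colourBy y → x ≡ y
colourBy-injective {x = true}  {true}  _ = refl
colourBy-injective {x = false} {false} _ = refl

colourBy-content : ∀ {m} (h : Fin (suc (suc m)) → Bool) →
                   colourCount (colourBy ∘ h) ≗ twoParts (countᶠ _ h) (countᶠ _ (not ∘ h))
colourBy-content {m} h zero          = countᶠ-cong λ v → first (h v)
  where
  first : ∀ x → (colourBy {m} x ==ᶠ zero) ≡ x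
  first true  = refl
  first false = refl
colourBy-content {m} h (suc zero)    = countᶠ-cong λ v → second (h v)
  where
  second : ∀ x → (colourBy {m} x ==ᶠ suc zero) ≡ not x
  second true  = refl
  second false = refl
colourBy-content {m} h (suc (suc c)) = countL-none (allFin _) _ λ v → unused (h v)
  where
  unused : ∀ x → ¬ T (colourBy x ==ᶠ suc (suc c))
  unused true  ()
  unused false ()

-- A colouring with content (a, b, 0, …) uses two colours only, so up to renaming it is h or not ∘ h.
twoColour-content : ∀ {m} {G : SimpleGraph (suc (suc m))} → Connected G →
                    {h : Fin (suc (suc m)) → Bool} {κ : Fin (suc (suc m)) → Fin (suc (suc m))} →
                    ∀ {a b} → Proper G h → Proper G κ → colourCount κ ≗ twoParts a b →
                    a ≡ countᶠ _ h ⊎ a ≡ countᶠ _ (not ∘ h)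
twoColour-content {m} {G} connected {h} {κ} {a} proper-h proper-κ content =
  ⊎-map count≡ count≡ (twoColouring-unique connected proper-h proper-first zero)
  where
  N : ℕ
  N = suc (suc m)

  first : Fin N → Bool
  first v = κ v ==ᶠ zero

  count≡ : {g : Fin N → Bool} → first ≗ g → a ≡ countᶠ N g
  count≡ first≗g = trans (sym (content zero)) (countᶠ-cong first≗g)

  twoValued : ∀ v → κ v ≡ zero ⊎ κ v ≡ suc zero
  twoValued v with κ v in κv≡
  ... | zero        = inj₁ refl
  ... | suc zero    = inj₂ refl
  ... | suc (suc c) = ⊥-elim (n≮0 (subst (0 <_) (content (suc (suc c)))
                        (countL-pos (λ w → κ w ==ᶠ suc (suc c)) (∈-allFin v) (≡⇒==ᶠ κv≡))))

  agree : ∀ {x y : Fin N} → x ≡ zero ⊎ x ≡ suc zero → y ≡ zero ⊎ y ≡ suc zero →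
          (x ==ᶠ zero) ≡ (y ==ᶠ zero) → x ≡ y
  agree (inj₁ refl) (inj₁ refl) _  = refl
  agree (inj₁ refl) (inj₂ refl) ()
  agree (inj₂ refl) (inj₁ refl) ()
  agree (inj₂ refl) (inj₂ refl) _  = refl

  proper-first : Proper G first
  proper-first u v uv = proper-κ u v uv ∘ agree (twoValued u) (twoValued v)

-- Semistandard tableaux

Filling : ℕ → Set
Filling n = Fin n → Fin n → Fin n

record IsSSYT {n : ℕ} (μ : Fin n → ℕ) (U : Filling n) : Set where
  field
    padded    : ∀ i j → μ i ≤ toℕ j → toℕ (U i j) ≡ 0
    rowWeak   : ∀ i {j j'} → toℕ j < toℕ j' → toℕ j' < μ i → toℕ (U i j) ≤ toℕ (U i j')
    colStrict : ∀ {i i'} j → toℕ i < toℕ i' → toℕ j < μ i' → toℕ (U i j) < toℕ (U i' j)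

rowCount : (Fin n → ℕ) → Filling n → Fin n → Fin n → ℕ
rowCount {n} μ U i k = countᶠ n (λ j → (toℕ j <ᵇ μ i) ∧ (U i j ==ᶠ k))

tabContent : (Fin n → ℕ) → Filling n → Fin n → ℕ
tabContent {n} μ U k = sumL (allFin n) (λ i → rowCount μ U i k)

-- Conjuncts of isSSYTᵇ, named because T-∧ cannot infer them when splitting T (isSSYTᵇ μ U).
paddedᵇ rowWeakᵇ : (Fin n → ℕ) → Filling n → Bool
paddedᵇ  {n} μ U = allᶠ n λ i → allᶠ n λ j → not (μ i ≤ᵇ toℕ j) ∨ (toℕ (U i j) ≡ᵇ 0)
rowWeakᵇ {n} μ U = allᶠ n λ i → allᶠ n λ j → allᶠ n λ j' →
  not (toℕ j <ᵇ toℕ j') ∨ not (toℕ j' <ᵇ μ i) ∨ (toℕ (U i j) ≤ᵇ toℕ (U i j'))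

module _ {μ : Fin n → ℕ} where

  isSSYTᵇ⁺ : {U : Filling n} → IsSSYT μ U → T (isSSYTᵇ μ U)
  isSSYTᵇ⁺ ssyt = from T-∧
    ( (allᶠ⁺ λ i → allᶠ⁺ λ j → impᵇ⁺ _ λ μi≤j → ≡⇒≡ᵇ _ 0 (padded i j (≤ᵇ⇒≤ _ _ μi≤j)))
    , from T-∧
      ( (allᶠ⁺ λ i → allᶠ⁺ λ j → allᶠ⁺ λ j' →
          impᵇ⁺ (toℕ j <ᵇ toℕ j') λ j<j' → impᵇ⁺ (toℕ j' <ᵇ μ i) λ j'<μi →
          ≤⇒≤ᵇ (rowWeak i (<ᵇ⇒< _ _ j<j') (<ᵇ⇒< _ _ j'<μi)))
      , (allᶠ⁺ λ i → allᶠ⁺ λ i' → allᶠ⁺ λ j →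
          impᵇ⁺ (toℕ i <ᵇ toℕ i') λ i<i' → impᵇ⁺ (toℕ j <ᵇ μ i') λ j<μi' →
          <⇒<ᵇ (colStrict j (<ᵇ⇒< _ _ i<i') (<ᵇ⇒< _ _ j<μi')))))
    where open IsSSYT ssyt

  isSSYTᵇ⁻ : {U : Filling n} → T (isSSYTᵇ μ U) → IsSSYT μ U
  isSSYTᵇ⁻ {U} t
    with tPadded , tOrder      ← T-∧⁻ (paddedᵇ μ U) t
    with tRowWeak , tColStrict ← T-∧⁻ (rowWeakᵇ μ U) tOrder = record
    { padded    = λ i j μi≤j → ≡ᵇ⇒≡ _ 0 (impᵇ⁻ _ (allᶠ⁻ (allᶠ⁻ tPadded i) j) (≤⇒≤ᵇ μi≤j))
    ; rowWeak   = λ i {j} {j'} j<j' j'<μi → ≤ᵇ⇒≤ _ _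
        (impᵇ⁻ _ (impᵇ⁻ _ (allᶠ⁻ (allᶠ⁻ (allᶠ⁻ tRowWeak i) j) j') (<⇒<ᵇ j<j')) (<⇒<ᵇ j'<μi))
    ; colStrict = λ {i} {i'} j i<i' j<μi' → <ᵇ⇒< _ _
        (impᵇ⁻ _ (impᵇ⁻ _ (allᶠ⁻ (allᶠ⁻ (allᶠ⁻ tColStrict i) i') j) (<⇒<ᵇ i<i')) (<⇒<ᵇ j<μi'))
    }

  IsSSYT-≗ : {U V : Filling n} → (∀ i j → V i j ≡ U i j) → IsSSYT μ U → IsSSYT μ V
  IsSSYT-≗ V≡U ssyt = record
    { padded    = λ i j μi≤j → trans (cong toℕ (V≡U i j)) (padded i j μi≤j)
    ; rowWeak   = λ i {j} {j'} j<j' j'<μi →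
        subst₂ _≤_ (cong toℕ (sym (V≡U i j))) (cong toℕ (sym (V≡U i j'))) (rowWeak i j<j' j'<μi)
    ; colStrict = λ {i} {i'} j i<i' j<μi' →
        subst₂ _<_ (cong toℕ (sym (V≡U i j))) (cong toℕ (sym (V≡U i' j))) (colStrict j i<i' j<μi')
    }
    where open IsSSYT ssyt

  tabContent-≗ : {U V : Filling n} → (∀ i j → V i j ≡ U i j) → tabContent μ V ≗ tabContent μ U
  tabContent-≗ V≡U k = sumL-cong (allFin n) λ i → countᶠ-cong λ j →
    cong (λ x → (toℕ j <ᵇ μ i) ∧ (x ==ᶠ k)) (V≡U i j)

  schurCoeff-pos : {U : Filling n} {α : Fin n → ℕ} → IsSSYT μ U → tabContent μ U ≗ α → 0 < schurCoeff μ α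
  schurCoeff-pos {U} {α} ssyt content
    with V , V∈ , V≗U ← funsL-complete _≗_ (funsL-allFin-complete n) n U =
    countL-pos (λ V → isSSYTᵇ μ V ∧ (allᶠ n λ k → tabContent μ V k ≡ᵇ α k)) V∈
      (from T-∧ ( isSSYTᵇ⁺ (IsSSYT-≗ V≗U ssyt)
                , allᶠ⁺ λ k → ≡⇒≡ᵇ _ _ (trans (tabContent-≗ V≗U k) (content k))))

  schurCoeff-witness : {α : Fin n → ℕ} → 0 < schurCoeff μ α → ∃[ U ] IsSSYT μ U × tabContent μ U ≗ α
  schurCoeff-witness {α} pos
    with U , t ← countL-witness (funsL n (funsL n (allFin n)))
                   (λ U → isSSYTᵇ μ U ∧ (allᶠ n λ k → tabContent μ U k ≡ᵇ α k)) pos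
    with tSSYT , tContent ← T-∧⁻ (isSSYTᵇ μ U) t =
    U , isSSYTᵇ⁻ tSSYT , λ k → ≡ᵇ⇒≡ _ _ (allᶠ⁻ tContent k)

module TabContent (μ : Fin n → ℕ) (U : Filling n) where

  cellᵇ : Fin n → Fin n → Fin n → Bool
  cellᵇ i k j = (toℕ j <ᵇ μ i) ∧ (U i j ==ᶠ k)

  cellᵇ⁺ : ∀ {i j k} → toℕ j < μ i → U i j ≡ k → T (cellᵇ i k j)
  cellᵇ⁺ j<μi Uij≡k = from T-∧ (<⇒<ᵇ j<μi , ≡⇒==ᶠ Uij≡k)

  cellᵇ⁻ : ∀ {i j k} → T (cellᵇ i k j) → toℕ j < μ i × U i j ≡ k
  cellᵇ⁻ {i} {j} t with j<μi , Uij==k ← T-∧⁻ (toℕ j <ᵇ μ i) t = <ᵇ⇒< _ _ j<μi , ==ᶠ⇒≡ Uij==k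

  rowCount≤tabContent : ∀ i k → rowCount μ U i k ≤ tabContent μ U k
  rowCount≤tabContent i k = ∈⇒≤sumL (λ i → rowCount μ U i k) (∈-allFin i)

  rowCount-none : ∀ {i k} → (∀ j → toℕ j < μ i → U i j ≢ k) → rowCount μ U i k ≡ 0
  rowCount-none {i} {k} none = countL-none (allFin n) (cellᵇ i k) λ j t →
    let j<μi , Uij≡k = cellᵇ⁻ t in none j j<μi Uij≡k

  rowCount-mono : ∀ {i i' k k'} → (∀ j → toℕ j < μ i → U i j ≡ k → toℕ j < μ i' × U i' j ≡ k') →
                  rowCount μ U i k ≤ rowCount μ U i' k'
  rowCount-mono cell⇒cell = countᶠ-mono λ j t →
    let j<μi  , Uij≡k   = cellᵇ⁻ t
        j<μi' , Ui'j≡k' = cell⇒cell j j<μi Uij≡k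
    in cellᵇ⁺ j<μi' Ui'j≡k'

  tabContent-pos : ∀ {i j k} → U i j ≡ k → toℕ j < μ i → 0 < tabContent μ U k
  tabContent-pos {i} {j} {k} Uij≡k j<μi =
    ≤-trans (countL-pos (cellᵇ i k) (∈-allFin j) (cellᵇ⁺ j<μi Uij≡k)) (rowCount≤tabContent i k)

  tabContent-witness : ∀ {k} → 0 < tabContent μ U k → ∃₂ λ i j → toℕ j < μ i × U i j ≡ k
  tabContent-witness {k} pos
    with i , _ , row>0 ← sumL-witness (allFin n) (λ i → rowCount μ U i k) pos
    with j , t         ← countL-witness (allFin n) (cellᵇ i k) row>0 =
    i , j , cellᵇ⁻ t

module _ (μ : Fin (suc n) → ℕ) (U : Filling (suc n)) where

  open TabContent

  tabContent-firstRow : ∀ {k} → (∀ r → rowCount μ U (suc r) k ≡ 0) →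
                        tabContent μ U k ≡ rowCount μ U zero k
  tabContent-firstRow {k} emptyBelow = trans (sumL-allFin-suc (λ i → rowCount μ U i k))
    (trans (cong (rowCount μ U zero k +_) (sumL-zero (allFin n) emptyBelow)) (+-identityʳ _))

  tabContent-updateFirstRow : ∀ {V : Filling (suc n)} {j₀ x y} →
    toℕ j₀ < μ zero → U zero j₀ ≡ x → V zero j₀ ≡ y →
    (∀ j → j ≢ j₀ → V zero j ≡ U zero j) → (∀ r j → V (suc r) j ≡ U (suc r) j) →
    ∀ k → indicator (x ==ᶠ k) + tabContent μ V k ≡ indicator (y ==ᶠ k) + tabContent μ U k
  tabContent-updateFirstRow {V} {j₀} {x} {y} j₀<μ₀ U₀j₀≡x V₀j₀≡y sameRow sameBelow k = begin
    [x] + tabContent μ V k                    ≡⟨ cong ([x] +_) (splitFirstRow V) ⟩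
    [x] + (rowCount μ V zero k + rowsBelow V) ≡⟨ +-assoc [x] _ _ ⟨
    [x] + rowCount μ V zero k + rowsBelow V   ≡⟨ cong₂ _+_ firstRow rowsBelow-≡ ⟩
    [y] + rowCount μ U zero k + rowsBelow U   ≡⟨ +-assoc [y] _ _ ⟩
    [y] + (rowCount μ U zero k + rowsBelow U) ≡⟨ cong ([y] +_) (splitFirstRow U) ⟨
    [y] + tabContent μ U k                    ∎
    where
    open ≡-Reasoning

    [x] [y] : ℕ
    [x] = indicator (x ==ᶠ k)
    [y] = indicator (y ==ᶠ k)

    rowsBelow : Filling (suc n) → ℕ
    rowsBelow W = sumL (allFin n) (λ r → rowCount μ W (suc r) k)

    splitFirstRow : ∀ W → tabContent μ W k ≡ rowCount μ W zero k + rowsBelow W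
    splitFirstRow W = sumL-allFin-suc (λ i → rowCount μ W i k)

    cell-j₀ : ∀ {W z} → W zero j₀ ≡ z → cellᵇ μ W zero k j₀ ≡ (z ==ᶠ k)
    cell-j₀ {W} refl = cong (_∧ (W zero j₀ ==ᶠ k)) (to T-≡ (<⇒<ᵇ j₀<μ₀))

    firstRow : [x] + rowCount μ V zero k ≡ [y] + rowCount μ U zero k
    firstRow = subst₂ (λ p q → indicator p + rowCount μ V zero k ≡ indicator q + rowCount μ U zero k)
      (cell-j₀ {U} U₀j₀≡x) (cell-j₀ {V} V₀j₀≡y)
      (countᶠ-update (cellᵇ μ V zero k) (cellᵇ μ U zero k) j₀ λ j j≢j₀ →
        cong (λ z → (toℕ j <ᵇ μ zero) ∧ (z ==ᶠ k)) (sameRow j j≢j₀))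

    rowsBelow-≡ : rowsBelow V ≡ rowsBelow U
    rowsBelow-≡ = sumL-cong (allFin n) λ r → countᶠ-cong λ j →
      cong (λ z → (toℕ j <ᵇ μ (suc r)) ∧ (z ==ᶠ k)) (sameBelow r j)

last-witness : {P : Fin n → Set} → Decidable P → ∃ P →
               ∃[ j ] P j × (∀ {j'} → toℕ j < toℕ j' → ¬ P j')
last-witness {suc n} P? (i , Pi) with any? (P? ∘ suc)
last-witness {suc n} P? (i , Pi) | yes later
  with j , Pj , last ← last-witness (P? ∘ suc) later =
  suc j , Pj , λ { {zero} () ; {suc j'} j<j' → last (≤-pred j<j') }
last-witness {suc n} P? (zero , P₀)  | no ¬later =
  zero , P₀ , λ { {zero} () ; {suc j'} _ Pj' → ¬later (j' , Pj') }
last-witness {suc n} P? (suc i , Pi) | no ¬later = ⊥-elim (¬later (i , Pi))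

module ShiftLastZero {m : ℕ} {μ : Fin (suc (suc m)) → ℕ} {U : Filling (suc (suc m))} {a b : ℕ}
                     (b<a : b < a) (ssyt : IsSSYT μ U)
                     (content : tabContent μ U ≗ twoParts (suc a) b) where

  private
    N : ℕ
    N = suc (suc m)

  open IsSSYT ssyt
  open TabContent μ U

  entry-0⊎1 : ∀ {i j} → toℕ j < μ i → U i j ≡ zero ⊎ U i j ≡ suc zero
  entry-0⊎1 {i} {j} j<μi with U i j in Uij≡
  ... | zero        = inj₁ refl
  ... | suc zero    = inj₂ refl
  ... | suc (suc c) = ⊥-elim (n≮0 (subst (0 <_) (content (suc (suc c))) (tabContent-pos Uij≡ j<μi)))

  entry≤1 : ∀ {i j} → toℕ j < μ i → toℕ (U i j) ≤ 1
  entry≤1 j<μi with entry-0⊎1 j<μi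
  ... | inj₁ Uij≡0 rewrite Uij≡0 = z≤n
  ... | inj₂ Uij≡1 rewrite Uij≡1 = s≤s z≤n

  belowFirstRow≡1 : ∀ r {j} → toℕ j < μ (suc r) → U (suc r) j ≡ suc zero
  belowFirstRow≡1 r {j} j<μ with entry-0⊎1 j<μ
  ... | inj₂ Urj≡1 = Urj≡1
  ... | inj₁ Urj≡0 =
    ⊥-elim (n≮0 (subst (λ x → toℕ (U zero j) < toℕ x) Urj≡0 (colStrict {zero} j (s≤s z≤n) j<μ)))

  belowFirstRow≢0 : ∀ r j → toℕ j < μ (suc r) → U (suc r) j ≢ zero
  belowFirstRow≢0 r j j<μ Urj≡0 = contradiction (trans (sym Urj≡0) (belowFirstRow≡1 r j<μ)) λ ()

  FirstRowZero : Fin N → Set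
  FirstRowZero j = toℕ j < μ zero × U zero j ≡ zero

  firstRowZero? : Decidable FirstRowZero
  firstRowZero? j = (toℕ j <? μ zero) ×-dec (U zero j ≟ zero)

  some-firstRowZero : ∃ FirstRowZero
  some-firstRowZero with tabContent-witness (subst (0 <_) (sym (content zero)) (s≤s z≤n))
  ... | zero  , j , j<μ₀ , U₀j≡0 = j , j<μ₀ , U₀j≡0
  ... | suc r , j , j<μ  , Urj≡0 = ⊥-elim (belowFirstRow≢0 r j j<μ Urj≡0)

  module Shift (js : Fin N) (js<μ₀ : toℕ js < μ zero) (U₀js≡0 : U zero js ≡ zero)
           (js-last : ∀ {j} → toℕ js < toℕ j → ¬ FirstRowZero j) where

    -- Otherwise every zero of the tableau has a one below it, and there are more zeros than ones.
    belowFirstRow-short : ∀ r → ¬ toℕ js < μ (suc r)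
    belowFirstRow-short r js<μ = <-irrefl refl (begin-strict
      b                               <⟨ b<a ⟩
      a                               <⟨ n<1+n a ⟩
      suc a                           ≡⟨ content zero ⟨
      tabContent μ U zero             ≡⟨ tabContent-firstRow μ U (rowCount-none ∘ belowFirstRow≢0) ⟩
      rowCount μ U zero zero          ≤⟨ rowCount-mono zeroAboveOne ⟩
      rowCount μ U (suc r) (suc zero) ≤⟨ rowCount≤tabContent (suc r) (suc zero) ⟩
      tabContent μ U (suc zero)       ≡⟨ content (suc zero) ⟩
      b                               ∎)
      where
      open ≤-Reasoning

      zeroAboveOne : ∀ j → toℕ j < μ zero → U zero j ≡ zero → toℕ j < μ (suc r) × U (suc r) j ≡ suc zero
      zeroAboveOne j j<μ₀ U₀j≡0 = j<μ , belowFirstRow≡1 r j<μ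
        where
        j<μ : toℕ j < μ (suc r)
        j<μ = ≤-<-trans (≮⇒≥ λ js<j → js-last js<j (j<μ₀ , U₀j≡0)) js<μ

    shifted : Filling N
    shifted zero j with j ≟ js
    ... | yes _ = suc zero
    ... | no  _ = U zero j
    shifted (suc r) j = U (suc r) j

    shifted-js : shifted zero js ≡ suc zero
    shifted-js with js ≟ js
    ... | yes _    = refl
    ... | no js≢js = contradiction refl js≢js

    shifted-elsewhere : ∀ j → j ≢ js → shifted zero j ≡ U zero j
    shifted-elsewhere j j≢js with j ≟ js
    ... | yes j≡js = contradiction j≡js j≢js
    ... | no  _    = refl

    shifted-padded : ∀ i j → μ i ≤ toℕ j → toℕ (shifted i j) ≡ 0
    shifted-padded zero j μ₀≤j with j ≟ js
    ... | yes refl = contradiction μ₀≤j (<⇒≱ js<μ₀)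
    ... | no  _    = padded zero j μ₀≤j
    shifted-padded (suc r) = padded (suc r)

    shifted-rowWeak : ∀ i {j j'} → toℕ j < toℕ j' → toℕ j' < μ i →
                      toℕ (shifted i j) ≤ toℕ (shifted i j')
    shifted-rowWeak zero {j} {j'} j<j' j'<μ₀ with j ≟ js | j' ≟ js
    ... | yes refl | yes refl = contradiction j<j' (<-irrefl refl)
    ... | yes refl | no  _    with entry-0⊎1 j'<μ₀
    ...   | inj₁ U₀j'≡0 = contradiction (j'<μ₀ , U₀j'≡0) (js-last j<j')
    ...   | inj₂ U₀j'≡1 rewrite U₀j'≡1 = s≤s z≤n
    shifted-rowWeak zero {j} {j'} j<j' j'<μ₀ | no _ | yes refl = entry≤1 (<-trans j<j' j'<μ₀)
    shifted-rowWeak zero {j} {j'} j<j' j'<μ₀ | no _ | no _     = rowWeak zero j<j' j'<μ₀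
    shifted-rowWeak (suc r) = rowWeak (suc r)

    shifted-colStrict : ∀ {i i'} j → toℕ i < toℕ i' → toℕ j < μ i' →
                        toℕ (shifted i j) < toℕ (shifted i' j)
    shifted-colStrict {i' = zero} j () _
    shifted-colStrict {zero} {suc r} j i<i' j<μ with j ≟ js
    ... | yes refl = contradiction j<μ (belowFirstRow-short r)
    ... | no  _    = colStrict j i<i' j<μ
    shifted-colStrict {suc r} {suc r'} j = colStrict j

    shifted-ssyt : IsSSYT μ shifted
    shifted-ssyt = record
      { padded = shifted-padded ; rowWeak = shifted-rowWeak ; colStrict = shifted-colStrict }

    shifted-content : tabContent μ shifted ≗ twoParts a (suc b)
    shifted-content k = balance k (tabContent-updateFirstRow μ U {V = shifted}
      js<μ₀ U₀js≡0 shifted-js shifted-elsewhere (λ _ _ → refl) k)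
      where
      balance : ∀ c → indicator (zero ==ᶠ c) + tabContent μ shifted c
                        ≡ indicator (suc zero ==ᶠ c) + tabContent μ U c →
                tabContent μ shifted c ≡ twoParts a (suc b) c
      balance zero          moved = cong pred (trans moved (content zero))
      balance (suc zero)    moved = trans moved (cong suc (content (suc zero)))
      balance (suc (suc c)) moved = trans moved (content (suc (suc c)))

  shift : ∃[ V ] IsSSYT μ V × tabContent μ V ≗ twoParts a (suc b)
  shift with js , (js<μ₀ , U₀js≡0) , js-last ← last-witness firstRowZero? some-firstRowZero =
    let open Shift js js<μ₀ U₀js≡0 js-last in shifted , shifted-ssyt , shifted-content

schurCoeff-shift : ∀ {m} {μ : Fin (suc (suc m)) → ℕ} {a b} → b < a →
                   0 < schurCoeff μ (twoParts (suc a) b) → 0 < schurCoeff μ (twoParts a (suc b))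
schurCoeff-shift {μ = μ} {a} {b} b<a pos =
  let U , ssyt , content   = schurCoeff-witness {μ = μ} {α = twoParts (suc a) b} pos
      V , ssyt′ , content′ = ShiftLastZero.shift b<a ssyt content
  in schurCoeff-pos {μ = μ} {U = V} {α = twoParts a (suc b)} ssyt′ content′

-- Schur positivity

*-pos⁻ : ∀ x y → 0 < x * y → 0 < x × 0 < y
*-pos⁻ (suc x) (suc y) _   = s≤s z≤n , s≤s z≤n
*-pos⁻ (suc x) zero    pos = contradiction (subst (0 <_) (*-zeroʳ (suc x)) pos) n≮0

schurPositive-transfer : {G : SimpleGraph n} {α β : Fin n → ℕ} → SchurPositive G →
                         (∀ μ → 0 < schurCoeff μ α → 0 < schurCoeff μ β) →
                         0 < chromCoeff G α → 0 < chromCoeff G β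
schurPositive-transfer {n} {α = α} {β} (c , expansion) schurα⇒schurβ pos =
  let μ , μ∈ , cK>0 = sumL-witness (partitions n) (λ μ → c μ * schurCoeff μ α)
                                      (subst (0 <_) (expansion α) pos)
      c>0 , K>0     = *-pos⁻ (c μ) (schurCoeff μ α) cK>0
  in subst (0 <_) (sym (expansion β))
       (≤-trans (*-mono-≤ c>0 (schurα⇒schurβ μ K>0)) (∈⇒≤sumL (λ μ → c μ * schurCoeff μ β) μ∈))

heavyClass-impossible : ∀ {m} {G : SimpleGraph (suc (suc m))} → Connected G → SchurPositive G →
                        {h : Fin (suc (suc m)) → Bool} → Proper G h →
                        ∀ {a} → countᶠ _ h ≡ suc a → countᶠ _ (not ∘ h) < a → ⊥
heavyClass-impossible {m} {G} connected schurPositive {h} proper {a} A≡1+a B<a =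
  let κ , proper-κ , content-κ = chromCoeff-witness {G = G} {α = twoParts a (suc B)} shifted-pos
  in [ (λ a≡A → <-irrefl (trans a≡A A≡1+a) (n<1+n a)) , (λ a≡B → <-irrefl (sym a≡B) B<a) ]′
       (twoColour-content connected proper proper-κ content-κ)
  where
  B : ℕ
  B = countᶠ _ (not ∘ h)

  h-pos : 0 < chromCoeff G (twoParts (suc a) B)
  h-pos = subst (λ A → 0 < chromCoeff G (twoParts A B)) A≡1+a
    (chromCoeff-pos {G = G} {κ = colourBy ∘ h} {α = twoParts (countᶠ _ h) B}
      (Proper-∘-injective {G = G} colourBy-injective proper) (colourBy-content h))

  shifted-pos : 0 < chromCoeff G (twoParts a (suc B))
  shifted-pos = schurPositive-transfer {G = G} {α = twoParts (suc a) B} {β = twoParts a (suc B)}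
    schurPositive (λ μ → schurCoeff-shift {μ = μ} B<a) h-pos

2+y≤x⇒x≡1+a∧y<a : ∀ {x y} → 2 + y ≤ x → ∃[ a ] x ≡ suc a × y < a
2+y≤x⇒x≡1+a∧y<a (s≤s y<a) = _ , refl , y<a

unbalanced-impossible : {G : SimpleGraph n} → Connected G → SchurPositive G →
                        {h : Fin n → Bool} → Proper G h → 2 + countᶠ n (not ∘ h) ≤ countᶠ n h → ⊥
unbalanced-impossible {zero}        _ _ _ ()
unbalanced-impossible {suc zero}    _ _ {h} _ heavy =
  contradiction (≤-trans heavy (countᶠ-≤ h)) λ { (s≤s ()) }
unbalanced-impossible {suc (suc m)} connected schurPositive proper heavy =
  let a , A≡1+a , B<a = 2+y≤x⇒x≡1+a∧y<a heavy
  in heavyClass-impossible connected schurPositive proper A≡1+a B<a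

∣x-y∣≤1⊎2+y≤x⊎2+x≤y : ∀ x y → ∣ x - y ∣ ≤ 1 ⊎ 2 + y ≤ x ⊎ 2 + x ≤ y
∣x-y∣≤1⊎2+y≤x⊎2+x≤y zero          zero          = inj₁ z≤n
∣x-y∣≤1⊎2+y≤x⊎2+x≤y zero          (suc zero)    = inj₁ (s≤s z≤n)
∣x-y∣≤1⊎2+y≤x⊎2+x≤y zero          (suc (suc y)) = inj₂ (inj₂ (s≤s (s≤s z≤n)))
∣x-y∣≤1⊎2+y≤x⊎2+x≤y (suc zero)    zero          = inj₁ (s≤s z≤n)
∣x-y∣≤1⊎2+y≤x⊎2+x≤y (suc (suc x)) zero          = inj₂ (inj₁ (s≤s (s≤s z≤n)))
∣x-y∣≤1⊎2+y≤x⊎2+x≤y (suc x)       (suc y)       = ⊎-map id (⊎-map s≤s s≤s) (∣x-y∣≤1⊎2+y≤x⊎2+x≤y x y)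

theorem3p3 : (n : ℕ) (G : SimpleGraph n) → Connected G → Bipartite G →
    SchurPositive G → BalancedStableBipartition G
theorem3p3 n G connected (h , proper) schurPositive
  with ∣x-y∣≤1⊎2+y≤x⊎2+x≤y (countᶠ n h) (countᶠ n (not ∘ h))
... | inj₁ balanced       = h , proper , balanced
... | inj₂ (inj₁ h-heavy) = ⊥-elim (unbalanced-impossible connected schurPositive proper h-heavy)
... | inj₂ (inj₂ h-light) = ⊥-elim (unbalanced-impossible connected schurPositive
                              (Proper-∘-injective {G = G} not-injective proper)
                              (subst (λ B → 2 + B ≤ countᶠ n (not ∘ h)) count-not∘not∘h h-light))
  where
  count-not∘not∘h : countᶠ n h ≡ countᶠ n (not ∘ (not ∘ h))
  count-not∘not∘h = countᶠ-cong (sym ∘ not-involutive ∘ h)
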